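{- For any integer $K \geq 0$, there is an even integer $n$ such that the independence equivalence class $[P_n]$ of the path $P_n$ on $n$ vertices has cardinality at least $K$.
   Context: All graphs are finite, undirected and simple, considered up to isomorphism. A set of vertices is independent if it induces no edges. The independence polynomial of a graph $G$ is $i(G,x)=\sum_{k\ge 0} i_k x^k$, where $i_k$ is the number of independent sets of size $k$ in $G$. Two graphs $G,H$ are independence equivalent ($G\sim H$) if $i(G,x)=i(H,x)$; the independence equivalence class $[G]$ is the set of (isomorphism classes of) graphs independence equivalent to $G$. $P_n$ denotes the path on $n$ vertices. -}

module Defs where

open import Data.Nat using (ℕ; zero; suc; _+_; _≡ᵇ_)
open import Data.Bool.Properties using (∨-comm)
open import Data.Bool using (Bool; true; false; _∧_; _∨_; not; if_then_else_)
open import Data.Fin as Fin using (Fin; toℕ)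
open import Data.Vec using (Vec; []; _∷_; lookup)
open import Data.List using (List; []; _∷_; map; _++_; length; filter)
open import Data.Product using (Σ; _×_; _,_; ∃-syntax)
open import Relation.Binary.PropositionalEquality using (_≡_; refl)
open import Relation.Nullary.Decidable using (Dec)
open import Function.Bundles using (_⤖_; Bijection)

record Graph (n : ℕ) : Set where
  field
    adj     : Fin n → Fin n → Bool
    adj-sym : ∀ i j → adj i j ≡ adj j i
    irrefl  : ∀ i → adj i i ≡ false
open Graph public

AnyGraph : Set
AnyGraph = Σ ℕ Graph

Iso : AnyGraph → AnyGraph → Set
Iso (m , G) (n , H) =
  Σ (Fin m ⤖ Fin n) λ f →
    ∀ i j → adj G i j ≡ adj H (Bijection.to f i) (Bijection.to f j)

allSubsets : (n : ℕ) → List (Vec Bool n)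
allSubsets zero    = [] ∷ []
allSubsets (suc n) = map (true ∷_) (allSubsets n) ++ map (false ∷_) (allSubsets n)

allFinᵇ : (n : ℕ) → (Fin n → Bool) → Bool
allFinᵇ zero    p = true
allFinᵇ (suc n) p = p Fin.zero ∧ allFinᵇ n (λ i → p (Fin.suc i))


size : {n : ℕ} → Vec Bool n → ℕ
size []            = 0
size (true  ∷ xs) = suc (size xs)
size (false ∷ xs) = size xs

isIndependent : {n : ℕ} → Graph n → Vec Bool n → Bool
isIndependent {n} G s =
  allFinᵇ n λ i → allFinᵇ n λ j →
    not (lookup s i ∧ lookup s j ∧ adj G i j)

countᵇ : {A : Set} → (A → Bool) → List A → ℕ
countᵇ p []       = 0
countᵇ p (x ∷ xs) = if p x then suc (countᵇ p xs) else countᵇ p xs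

-- i_k(G): the number of independent sets of size k in G
-- (the k-th coefficient of the independence polynomial i(G,x)).
indepCoeff : AnyGraph → ℕ → ℕ
indepCoeff (n , G) k =
  countᵇ (λ s → isIndependent G s ∧ (size s ≡ᵇ k)) (allSubsets n)

IndepEquiv : AnyGraph → AnyGraph → Set
IndepEquiv G H = ∀ k → indepCoeff G k ≡ indepCoeff H k

pathAdj : (n : ℕ) → Fin n → Fin n → Bool
pathAdj n i j = (suc (toℕ i) ≡ᵇ toℕ j) ∨ (suc (toℕ j) ≡ᵇ toℕ i)

suc≡ᵇ-false : ∀ x → (suc x ≡ᵇ x) ≡ false
suc≡ᵇ-false zero    = refl
suc≡ᵇ-false (suc x) = suc≡ᵇ-false x

P : (n : ℕ) → AnyGraph
P n = n , record
  { adj     = pathAdj n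
  ; adj-sym = λ i j → ∨-comm (suc (toℕ i) ≡ᵇ toℕ j) (suc (toℕ j) ≡ᵇ toℕ i)
  ; irrefl  = λ i → irr (toℕ i)
  }
  where
  irr : ∀ x → ((suc x ≡ᵇ x) ∨ (suc x ≡ᵇ x)) ≡ false
  irr x rewrite suc≡ᵇ-false x = refl

-- Let A i = order i, so A 0 = 1 and A (i + 1) = 2 A i + 2. In the path on A t vertices choose
-- markers m = A j for s ≤ j < t and at each replace the edge m − 1 — m by the edge m — m + 2.
-- Cutting in front of the top marker A = A (t − 1) leaves a graph of the same kind on A vertices
-- and a triangle with a pendant path on A + 2 vertices, with independence polynomials i(P_A)
-- and i(P_{A+1}) + x i(P_{A−1}); by the addition formula for Fibonacci polynomials their product
-- is i(P_{2A+2}), so by induction each such graph is independence equivalent to P_{A t}.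
-- Markers are at least four apart when s ≥ 1, so the vertices with three neighbours are exactly
-- the vertices m + 2: graphs with different numbers of markers are not isomorphic, and t = K + 1
-- with 0, …, K − 1 markers gives K of them, on the even number A (K + 1) of vertices.

module Submission where

open import Defs
open import Data.Nat using (ℕ; zero; suc; pred; _+_; _*_; _∸_; _<_; _≤_; _≤′_; ≤′-refl; ≤′-step; s≤s; z≤n; _≡ᵇ_)
open import Data.Nat.Properties
  using ( +-assoc; +-comm; +-identityʳ; +-suc; +-cancelʳ-≡; +-monoˡ-≤; +-commutativeSemigroup
        ; *-comm; *-distribʳ-+; suc-injective; ≡ᵇ⇒≡; ≡⇒≡ᵇ
        ; ≤-refl; ≤-reflexive; ≤-trans; ≤-antisym; <-≤-trans; <-cmp; ≤⇒≤′
        ; <⇒≤; <⇒≢; >⇒≢; <⇒≱; ≰⇒>; m≤n⇒m<n∨m≡n; n≤1+n; m≤m+n; m≤n+m; m<m+n; m<n+m; m+[n∸m]≡n )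
open import Algebra.Properties.CommutativeSemigroup +-commutativeSemigroup using (interchange)
open import Data.Bool using (Bool; true; false; _∧_; _∨_; not; T)
open import Data.Bool.Properties
  using (∨-comm; ∨-zeroʳ; ∨-identityʳ; ∧-zeroʳ; ∧-identityʳ; ∧-assoc; ∧-idem; ¬-not; T-≡; T-not-≡; T-∧; T-∨)
open import Data.Fin as Fin using (Fin; toℕ; fromℕ; fromℕ<; inject₁)
open import Data.Fin.Properties using (toℕ-injective; toℕ-fromℕ; toℕ-fromℕ<; toℕ-inject₁; toℕ<n; injective⇒≤)
open import Data.Vec using (Vec; []; _∷_; lookup)
open import Data.List using ([]; _∷_; map; _++_)
open import Data.Product using (Σ; _×_; _,_; proj₁; proj₂; ∃-syntax)
open import Data.Sum using (_⊎_; inj₁; inj₂)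
open import Data.Empty using (⊥-elim)
open import Function using (_∘_)
open import Function.Bundles using (Bijection; Equivalence)
open import Function.Definitions using (Injective)
open import Function.Properties.Bijection using (sym-≡)
open import Relation.Nullary using (¬_)
open import Relation.Binary.Definitions using (tri<; tri≈; tri>)
open import Relation.Binary.PropositionalEquality
import Relation.Binary.Reasoning.Setoid

-- Polynomials with natural coefficients

Poly : Set
Poly = ℕ → ℕ

𝟘 𝟙 : Poly
𝟘 _ = 0
𝟙 zero    = 1
𝟙 (suc _) = 0

infixr 8 x·_
infixl 7 _⊛_
infixl 6 _⊕_

x·_ : Poly → Poly
(x· p) zero    = 0
(x· p) (suc k) = p k

_⊕_ : Poly → Poly → Poly
(p ⊕ q) k = p k + q k

tail : Poly → Poly
tail p k = p (suc k)

_⊛_ : Poly → Poly → Poly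
(p ⊛ q) zero    = p 0 * q 0
(p ⊛ q) (suc k) = p 0 * q (suc k) + (tail p ⊛ q) k

module ≗-Reasoning = Relation.Binary.Reasoning.Setoid (ℕ →-setoid ℕ)

⊕-cong : ∀ {p p′ q q′} → p ≗ p′ → q ≗ q′ → p ⊕ q ≗ p′ ⊕ q′
⊕-cong e f k = cong₂ _+_ (e k) (f k)

⊕-identityʳ : ∀ p → p ⊕ 𝟘 ≗ p
⊕-identityʳ p k = +-identityʳ (p k)

⊕-interchange : ∀ p q r s → (p ⊕ q) ⊕ (r ⊕ s) ≗ (p ⊕ r) ⊕ (q ⊕ s)
⊕-interchange p q r s k = interchange (p k) (q k) (r k) (s k)

x·-cong : ∀ {p q} → p ≗ q → x· p ≗ x· q
x·-cong e zero    = refl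
x·-cong e (suc k) = e k

x·-zero : x· 𝟘 ≗ 𝟘
x·-zero zero    = refl
x·-zero (suc k) = refl

x·-distrib-⊕ : ∀ p q → x· (p ⊕ q) ≗ x· p ⊕ x· q
x·-distrib-⊕ p q zero    = refl
x·-distrib-⊕ p q (suc k) = refl

⊛-cong : ∀ {p p′ q q′} → p ≗ p′ → q ≗ q′ → p ⊛ q ≗ p′ ⊛ q′
⊛-cong e f zero    = cong₂ _*_ (e 0) (f 0)
⊛-cong e f (suc k) = cong₂ _+_ (cong₂ _*_ (e 0) (f (suc k))) (⊛-cong (e ∘ suc) f k)

⊛-zeroˡ : ∀ q → 𝟘 ⊛ q ≗ 𝟘
⊛-zeroˡ q zero    = refl
⊛-zeroˡ q (suc k) = ⊛-zeroˡ q k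

⊛-identityˡ : ∀ q → 𝟙 ⊛ q ≗ q
⊛-identityˡ q zero    = +-identityʳ (q 0)
⊛-identityˡ q (suc k) = trans (cong₂ _+_ (+-identityʳ (q (suc k))) (⊛-zeroˡ q k)) (+-identityʳ _)

x·-⊛ : ∀ p q → x· p ⊛ q ≗ x· (p ⊛ q)
x·-⊛ p q zero    = refl
x·-⊛ p q (suc k) = refl

⊛-distribʳ-⊕ : ∀ p q r → (p ⊕ q) ⊛ r ≗ p ⊛ r ⊕ q ⊛ r
⊛-distribʳ-⊕ p q r zero    = *-distribʳ-+ (r 0) (p 0) (q 0)
⊛-distribʳ-⊕ p q r (suc k) = trans
  (cong₂ _+_ (*-distribʳ-+ (r (suc k)) (p 0) (q 0)) (⊛-distribʳ-⊕ (tail p) (tail q) r k))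
  (interchange (p 0 * r (suc k)) (q 0 * r (suc k)) ((tail p ⊛ r) k) ((tail q ⊛ r) k))

⊛-suc-tailʳ : ∀ p q k → (p ⊛ q) (suc k) ≡ (p ⊛ tail q) k + p (suc k) * q 0
⊛-suc-tailʳ p q zero    = refl
⊛-suc-tailʳ p q (suc k) = trans
  (cong (p 0 * q (suc (suc k)) +_) (⊛-suc-tailʳ (tail p) q k))
  (sym (+-assoc (p 0 * q (suc (suc k))) _ _))

⊛-comm : ∀ p q → p ⊛ q ≗ q ⊛ p
⊛-comm p q zero    = *-comm (p 0) (q 0)
⊛-comm p q (suc k) = begin
  p 0 * q (suc k) + (tail p ⊛ q) k  ≡⟨ cong₂ _+_ (*-comm (p 0) (q (suc k))) (⊛-comm (tail p) q k) ⟩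
  q (suc k) * p 0 + (q ⊛ tail p) k  ≡⟨ +-comm (q (suc k) * p 0) _ ⟩
  (q ⊛ tail p) k + q (suc k) * p 0  ≡⟨ ⊛-suc-tailʳ q p k ⟨
  (q ⊛ p) (suc k)                   ∎
  where open ≡-Reasoning

⊛-distribˡ-⊕ : ∀ p q r → p ⊛ (q ⊕ r) ≗ p ⊛ q ⊕ p ⊛ r
⊛-distribˡ-⊕ p q r = begin
  p ⊛ (q ⊕ r)    ≈⟨ ⊛-comm p (q ⊕ r) ⟩
  (q ⊕ r) ⊛ p    ≈⟨ ⊛-distribʳ-⊕ q r p ⟩
  q ⊛ p ⊕ r ⊛ p  ≈⟨ ⊕-cong (⊛-comm q p) (⊛-comm r p) ⟩
  p ⊛ q ⊕ p ⊛ r  ∎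
  where open ≗-Reasoning

⊛-x· : ∀ p q → p ⊛ x· q ≗ x· (p ⊛ q)
⊛-x· p q = begin
  p ⊛ x· q      ≈⟨ ⊛-comm p (x· q) ⟩
  x· q ⊛ p      ≈⟨ x·-⊛ q p ⟩
  x· (q ⊛ p)    ≈⟨ x·-cong (⊛-comm q p) ⟩
  x· (p ⊛ q)    ∎
  where open ≗-Reasoning

⊛-step : ∀ p q r → (p ⊕ x· q) ⊛ r ≗ p ⊛ r ⊕ x· (q ⊛ r)
⊛-step p q r = begin
  (p ⊕ x· q) ⊛ r      ≈⟨ ⊛-distribʳ-⊕ p (x· q) r ⟩
  p ⊛ r ⊕ x· q ⊛ r    ≈⟨ ⊕-cong (λ _ → refl) (x·-⊛ q r) ⟩
  p ⊛ r ⊕ x· (q ⊛ r)  ∎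
  where open ≗-Reasoning

fib : ℕ → Poly
fib zero          = 𝟘
fib (suc zero)    = 𝟙
fib (suc (suc n)) = fib (suc n) ⊕ x· fib n

fib-+-base : ∀ p q → fib 1 ⊛ p ⊕ x· (fib 0 ⊛ q) ≗ p
fib-+-base p q = begin
  𝟙 ⊛ p ⊕ x· (𝟘 ⊛ q)  ≈⟨ ⊕-cong (⊛-identityˡ p) (x·-cong (⊛-zeroˡ q)) ⟩
  p ⊕ x· 𝟘            ≈⟨ ⊕-cong (λ _ → refl) x·-zero ⟩
  p ⊕ 𝟘               ≈⟨ ⊕-identityʳ p ⟩
  p                   ∎
  where open ≗-Reasoning

fib-+ : ∀ m n → fib (suc (m + n)) ≗ fib (suc m) ⊛ fib (suc n) ⊕ x· (fib m ⊛ fib n)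
fib-+ zero n k = sym (fib-+-base (fib (suc n)) (fib n) k)
fib-+ (suc zero) n = begin
  fib (suc n) ⊕ x· fib n
    ≈⟨ ⊕-cong (fib-+-base (fib (suc n)) (fib (suc n))) (x·-cong (⊛-identityˡ (fib n))) ⟨
  𝟙 ⊛ fib (suc n) ⊕ x· (𝟘 ⊛ fib (suc n)) ⊕ x· (𝟙 ⊛ fib n)
    ≈⟨ ⊕-cong (⊛-step 𝟙 𝟘 (fib (suc n))) (λ _ → refl) ⟨
  fib 2 ⊛ fib (suc n) ⊕ x· (fib 1 ⊛ fib n)
    ∎
  where open ≗-Reasoning
fib-+ (suc (suc m)) n = begin
  fib (suc (suc (m + n))) ⊕ x· fib (suc (m + n))
    ≈⟨ ⊕-cong (fib-+ (suc m) n) (x·-cong (fib-+ m n)) ⟩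
  (F₂ ⊛ G₁ ⊕ x· (F₁ ⊛ G₀)) ⊕ x· (F₁ ⊛ G₁ ⊕ x· (F₀ ⊛ G₀))
    ≈⟨ ⊕-cong (λ _ → refl) (x·-distrib-⊕ (F₁ ⊛ G₁) (x· (F₀ ⊛ G₀))) ⟩
  (F₂ ⊛ G₁ ⊕ x· (F₁ ⊛ G₀)) ⊕ (x· (F₁ ⊛ G₁) ⊕ x· x· (F₀ ⊛ G₀))
    ≈⟨ ⊕-interchange (F₂ ⊛ G₁) (x· (F₁ ⊛ G₀)) (x· (F₁ ⊛ G₁)) (x· x· (F₀ ⊛ G₀)) ⟩
  (F₂ ⊛ G₁ ⊕ x· (F₁ ⊛ G₁)) ⊕ (x· (F₁ ⊛ G₀) ⊕ x· x· (F₀ ⊛ G₀))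
    ≈⟨ ⊕-cong (⊛-step F₂ F₁ G₁) (x·-distrib-⊕ (F₁ ⊛ G₀) (x· (F₀ ⊛ G₀))) ⟨
  (F₂ ⊕ x· F₁) ⊛ G₁ ⊕ x· (F₁ ⊛ G₀ ⊕ x· (F₀ ⊛ G₀))
    ≈⟨ ⊕-cong (λ _ → refl) (x·-cong (⊛-step F₁ F₀ G₀)) ⟨
  (F₂ ⊕ x· F₁) ⊛ G₁ ⊕ x· ((F₁ ⊕ x· F₀) ⊛ G₀)
    ∎
  where
  open ≗-Reasoning
  F₀ = fib m
  F₁ = fib (suc m)
  F₂ = fib (suc (suc m))
  G₀ = fib n
  G₁ = fib (suc n)

fib-double : ∀ n → fib (2 + n) ⊛ (fib (3 + n) ⊕ x· fib (1 + n)) ≗ fib (4 + (n + n))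
fib-double n = begin
  F₂ ⊛ (F₃ ⊕ x· F₁)         ≈⟨ ⊛-distribˡ-⊕ F₂ F₃ (x· F₁) ⟩
  F₂ ⊛ F₃ ⊕ F₂ ⊛ x· F₁      ≈⟨ ⊕-cong (⊛-comm F₂ F₃) (⊛-x· F₂ F₁) ⟩
  F₃ ⊛ F₂ ⊕ x· (F₂ ⊛ F₁)    ≈⟨ fib-+ (2 + n) (1 + n) ⟨
  fib (suc (2 + n + suc n)) ≡⟨ cong (λ m → fib (3 + m)) (+-suc n n) ⟩
  fib (4 + (n + n))         ∎
  where
  open ≗-Reasoning
  F₁ = fib (1 + n)
  F₂ = fib (2 + n)
  F₃ = fib (3 + n)

countᵇ-++ : ∀ {A : Set} (p : A → Bool) xs ys → countᵇ p (xs ++ ys) ≡ countᵇ p xs + countᵇ p ys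
countᵇ-++ p []       ys = refl
countᵇ-++ p (x ∷ xs) ys with p x
... | true  = cong suc (countᵇ-++ p xs ys)
... | false = countᵇ-++ p xs ys

countᵇ-map : ∀ {A B : Set} (p : B → Bool) (f : A → B) xs → countᵇ p (map f xs) ≡ countᵇ (p ∘ f) xs
countᵇ-map p f []       = refl
countᵇ-map p f (x ∷ xs) with p (f x)
... | true  = cong suc (countᵇ-map p f xs)
... | false = countᵇ-map p f xs

countᵇ-cong : ∀ {A : Set} {p q : A → Bool} → p ≗ q → ∀ xs → countᵇ p xs ≡ countᵇ q xs
countᵇ-cong e []       = refl
countᵇ-cong {q = q} e (x ∷ xs) rewrite e x with q x
... | true  = cong suc (countᵇ-cong e xs)
... | false = countᵇ-cong e xs

countᵇ-none : ∀ {A : Set} {p : A → Bool} → (∀ x → p x ≡ false) → ∀ xs → countᵇ p xs ≡ 0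
countᵇ-none e []       = refl
countᵇ-none e (x ∷ xs) rewrite e x = countᵇ-none e xs

subsetPoly : (n : ℕ) → (Vec Bool n → Bool) → Poly
subsetPoly n p k = countᵇ (λ s → p s ∧ (size s ≡ᵇ k)) (allSubsets n)

subsetPoly-cong : ∀ n {p q : Vec Bool n → Bool} → p ≗ q → subsetPoly n p ≗ subsetPoly n q
subsetPoly-cong n e k = countᵇ-cong (λ s → cong (_∧ (size s ≡ᵇ k)) (e s)) (allSubsets n)

subsetPoly-none : ∀ n {p : Vec Bool n → Bool} → (∀ s → p s ≡ false) → subsetPoly n p ≗ 𝟘
subsetPoly-none n e k = countᵇ-none (λ s → cong (_∧ (size s ≡ᵇ k)) (e s)) (allSubsets n)

subsetPoly-suc : ∀ n (p : Vec Bool (suc n) → Bool) →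
  subsetPoly (suc n) p ≗ subsetPoly n (p ∘ (false ∷_)) ⊕ x· subsetPoly n (p ∘ (true ∷_))
subsetPoly-suc n p k = begin
  countᵇ q (map (true ∷_) S ++ map (false ∷_) S)
    ≡⟨ countᵇ-++ q (map (true ∷_) S) (map (false ∷_) S) ⟩
  countᵇ q (map (true ∷_) S) + countᵇ q (map (false ∷_) S)
    ≡⟨ cong₂ _+_ (countᵇ-map q (true ∷_) S) (countᵇ-map q (false ∷_) S) ⟩
  countᵇ (q ∘ (true ∷_)) S + subsetPoly n (p ∘ (false ∷_)) k
    ≡⟨ +-comm _ (subsetPoly n (p ∘ (false ∷_)) k) ⟩
  subsetPoly n (p ∘ (false ∷_)) k + countᵇ (q ∘ (true ∷_)) S
    ≡⟨ cong (subsetPoly n (p ∘ (false ∷_)) k +_) (taken k) ⟩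
  subsetPoly n (p ∘ (false ∷_)) k + (x· subsetPoly n (p ∘ (true ∷_))) k
    ∎
  where
  open ≡-Reasoning
  S = allSubsets n
  q = λ s → p s ∧ (size s ≡ᵇ k)
  taken : ∀ k → countᵇ (λ s → p (true ∷ s) ∧ (suc (size s) ≡ᵇ k)) S ≡ (x· subsetPoly n (p ∘ (true ∷_))) k
  taken zero    = countᵇ-none (λ s → ∧-zeroʳ (p (true ∷ s))) S
  taken (suc k) = refl

allFinᵇ-cong : ∀ n {p q : Fin n → Bool} → p ≗ q → allFinᵇ n p ≡ allFinᵇ n q
allFinᵇ-cong zero    e = refl
allFinᵇ-cong (suc n) e = cong₂ _∧_ (e Fin.zero) (allFinᵇ-cong n (e ∘ Fin.suc))

allFinᵇ-true : ∀ n → allFinᵇ n (λ _ → true) ≡ true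
allFinᵇ-true zero    = refl
allFinᵇ-true (suc n) = allFinᵇ-true n

∧-interchange : ∀ a b c d → (a ∧ b) ∧ (c ∧ d) ≡ (a ∧ c) ∧ (b ∧ d)
∧-interchange false b     c d = refl
∧-interchange true  true  c d = refl
∧-interchange true  false c d = sym (∧-zeroʳ c)

allFinᵇ-∧ : ∀ n (p q : Fin n → Bool) → allFinᵇ n (λ i → p i ∧ q i) ≡ allFinᵇ n p ∧ allFinᵇ n q
allFinᵇ-∧ zero    p q = refl
allFinᵇ-∧ (suc n) p q = trans
  (cong ((p Fin.zero ∧ q Fin.zero) ∧_) (allFinᵇ-∧ n (p ∘ Fin.suc) (q ∘ Fin.suc)))
  (∧-interchange (p Fin.zero) (q Fin.zero) _ _)

avoids : ∀ {n} → (ℕ → Bool) → Vec Bool n → Bool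
avoids F []      = true
avoids F (b ∷ s) = not (b ∧ F 0) ∧ avoids (F ∘ suc) s

allFinᵇ-avoids : ∀ {n} F (s : Vec Bool n) → allFinᵇ n (λ j → not (lookup s j ∧ F (toℕ j))) ≡ avoids F s
allFinᵇ-avoids F []      = refl
allFinᵇ-avoids F (b ∷ s) = cong (not (b ∧ F 0) ∧_) (allFinᵇ-avoids (F ∘ suc) s)

avoids-cong : ∀ {n} {F G : ℕ → Bool} → F ≗ G → (s : Vec Bool n) → avoids F s ≡ avoids G s
avoids-cong e []      = refl
avoids-cong e (b ∷ s) = cong₂ (λ x y → not (b ∧ x) ∧ y) (e 0) (avoids-cong (e ∘ suc) s)

avoids-∨ : ∀ {n} F G (s : Vec Bool n) → avoids (λ j → F j ∨ G j) s ≡ avoids F s ∧ avoids G s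
avoids-∨ F G []          = refl
avoids-∨ F G (false ∷ s) = avoids-∨ (F ∘ suc) (G ∘ suc) s
avoids-∨ F G (true ∷ s) rewrite avoids-∨ (F ∘ suc) (G ∘ suc) s with F 0 | G 0
... | true  | _     = refl
... | false | true  = sym (∧-zeroʳ _)
... | false | false = refl

independent : ∀ {n} → (ℕ → ℕ → Bool) → Vec Bool n → Bool
independent A []      = true
independent A (b ∷ s) = (not b ∨ avoids (A 0 ∘ suc) s) ∧ independent (λ i j → A (suc i) (suc j)) s

noEdgeWithin : ∀ {n} → (ℕ → ℕ → Bool) → Vec Bool n → Bool
noEdgeWithin {n} A s = allFinᵇ n λ i → allFinᵇ n λ j → not (lookup s i ∧ lookup s j ∧ A (toℕ i) (toℕ j))

noEdgeWithin≡independent : ∀ {n} A → (∀ i j → A i j ≡ A j i) → (∀ i → A i i ≡ false) →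
  (s : Vec Bool n) → noEdgeWithin A s ≡ independent A s
noEdgeWithin≡independent A A-sym A-irr [] = refl
noEdgeWithin≡independent {suc n} A A-sym A-irr (false ∷ s) = begin
  allFinᵇ n (λ _ → true) ∧ allFinᵇ n (λ i → not (lookup s i ∧ false) ∧ R i)
    ≡⟨ cong₂ _∧_ (allFinᵇ-true n)
                 (allFinᵇ-cong n (λ i → cong (λ z → not z ∧ R i) (∧-zeroʳ (lookup s i)))) ⟩
  noEdgeWithin A′ s
    ≡⟨ noEdgeWithin≡independent A′ (λ i j → A-sym (suc i) (suc j)) (A-irr ∘ suc) s ⟩
  independent A′ s
    ∎
  where
  open ≡-Reasoning
  A′ = λ i j → A (suc i) (suc j)
  R = λ i → allFinᵇ n λ j → not (lookup s i ∧ lookup s j ∧ A′ (toℕ i) (toℕ j))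
noEdgeWithin≡independent {suc n} A A-sym A-irr (true ∷ s) = begin
  (not (A 0 0) ∧ X) ∧ allFinᵇ n (λ i → not (lookup s i ∧ A (suc (toℕ i)) 0) ∧ R i)
    ≡⟨ cong₂ _∧_ (cong (λ z → not z ∧ X) (A-irr 0)) (allFinᵇ-∧ n _ R) ⟩
  X ∧ (allFinᵇ n (λ i → not (lookup s i ∧ A (suc (toℕ i)) 0)) ∧ noEdgeWithin A′ s)
    ≡⟨ cong (λ z → X ∧ (z ∧ noEdgeWithin A′ s))
            (allFinᵇ-cong n (λ i → cong (λ z → not (lookup s i ∧ z)) (A-sym _ 0))) ⟩
  X ∧ (X ∧ noEdgeWithin A′ s)
    ≡⟨ sym (∧-assoc X X _) ⟩
  (X ∧ X) ∧ noEdgeWithin A′ s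
    ≡⟨ cong₂ _∧_ (trans (∧-idem X) (allFinᵇ-avoids (A 0 ∘ suc) s))
                 (noEdgeWithin≡independent A′ (λ i j → A-sym (suc i) (suc j)) (A-irr ∘ suc) s) ⟩
  avoids (A 0 ∘ suc) s ∧ independent A′ s
    ∎
  where
  open ≡-Reasoning
  A′ = λ i j → A (suc i) (suc j)
  X = allFinᵇ n λ j → not (lookup s j ∧ A 0 (suc (toℕ j)))
  R = λ i → allFinᵇ n λ j → not (lookup s i ∧ lookup s j ∧ A′ (toℕ i) (toℕ j))

indepCoeff-cong : ∀ {n} {G H : Graph n} → (∀ i j → adj G i j ≡ adj H i j) →
  indepCoeff (n , G) ≗ indepCoeff (n , H)
indepCoeff-cong {n} e = subsetPoly-cong n λ s → allFinᵇ-cong n λ i → allFinᵇ-cong n λ j →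
  cong (λ z → not (lookup s i ∧ lookup s j ∧ z)) (e i j)

blocked : Bool → Bool → ℕ → Bool
blocked b₀ b₁ zero    = b₀
blocked b₀ b₁ (suc j) = blocked b₁ false j

blocked-none : ∀ j → blocked false false j ≡ false
blocked-none zero    = refl
blocked-none (suc j) = blocked-none j

blocked-∨ : ∀ a₀ a₁ b₀ b₁ j → blocked a₀ a₁ j ∨ blocked b₀ b₁ j ≡ blocked (a₀ ∨ b₀) (a₁ ∨ b₁) j
blocked-∨ a₀ a₁ b₀ b₁ zero    = refl
blocked-∨ a₀ a₁ b₀ b₁ (suc j) = blocked-∨ a₁ false b₁ false j

avoids-none : ∀ {n} (s : Vec Bool n) → avoids (blocked false false) s ≡ true
avoids-none []      = refl
avoids-none (b ∷ s) = cong₂ _∧_ (cong not (∧-zeroʳ b)) (avoids-none s)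

-- Branch vertices, an isomorphism invariant

Iso-sym : ∀ {G H} → Iso G H → Iso H G
Iso-sym {m , G} {n , H} (f , preserves) = sym-≡ f , λ i j →
  subst₂ (λ x y → adj H x y ≡ adj G (to⁻ i) (to⁻ j)) (to∘to⁻ i) (to∘to⁻ j)
    (sym (preserves (to⁻ i) (to⁻ j)))
  where
  open Bijection f using (to; to⁻; strictlySurjective)
  to∘to⁻ : ∀ y → to (to⁻ y) ≡ y
  to∘to⁻ = proj₂ ∘ strictlySurjective

HasThreeNeighbours : ∀ {n} → Graph n → Fin n → Set
HasThreeNeighbours {n} G v = Σ (Fin 3 → Fin n) λ u → Injective _≡_ _≡_ u × (∀ i → T (adj G v (u i)))

HasBranchVertices : ∀ {n} → Graph n → ℕ → Set
HasBranchVertices {n} G r = Σ (Fin r → Fin n) λ g → Injective _≡_ _≡_ g × (∀ i → HasThreeNeighbours G (g i))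

HasBranchVertices-Iso : ∀ {m n} {G : Graph m} {H : Graph n} {r} →
  Iso (m , G) (n , H) → HasBranchVertices G r → HasBranchVertices H r
HasBranchVertices-Iso (f , preserves) (g , g-inj , three) =
  to ∘ g , g-inj ∘ injective , λ i → let (u , u-inj , u-adj) = three i in
    to ∘ u , u-inj ∘ injective , λ c → subst T (preserves (g i) (u c)) (u-adj c)
  where open Bijection f using (to; injective)

-- Layout graphs: edges only between i and i + 1 or i + 2

record Layout : Set where
  field
    short : ℕ → Bool
    long  : ℕ → Bool
open Layout

shift : Layout → Layout
shift Λ = record { short = short Λ ∘ suc ; long = long Λ ∘ suc }

shiftBy : ℕ → Layout → Layout
shiftBy m Λ = record { short = short Λ ∘ (m +_) ; long = long Λ ∘ (m +_) }

forwardEdge : Layout → ℕ → ℕ → Bool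
forwardEdge Λ i j = ((suc i ≡ᵇ j) ∧ short Λ i) ∨ ((2 + i ≡ᵇ j) ∧ long Λ i)

layoutAdj : Layout → ℕ → ℕ → Bool
layoutAdj Λ i j = forwardEdge Λ i j ∨ forwardEdge Λ j i

2+≡ᵇ-false : ∀ i → (2 + i ≡ᵇ i) ≡ false
2+≡ᵇ-false zero    = refl
2+≡ᵇ-false (suc i) = 2+≡ᵇ-false i

forwardEdge-irrefl : ∀ Λ i → forwardEdge Λ i i ≡ false
forwardEdge-irrefl Λ i rewrite suc≡ᵇ-false i | 2+≡ᵇ-false i = refl

layoutAdj-sym : ∀ Λ i j → layoutAdj Λ i j ≡ layoutAdj Λ j i
layoutAdj-sym Λ i j = ∨-comm (forwardEdge Λ i j) (forwardEdge Λ j i)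

layoutAdj-irrefl : ∀ Λ i → layoutAdj Λ i i ≡ false
layoutAdj-irrefl Λ i = cong₂ _∨_ (forwardEdge-irrefl Λ i) (forwardEdge-irrefl Λ i)

layoutGraph : Layout → (n : ℕ) → Graph n
layoutGraph Λ n = record
  { adj     = λ i j → layoutAdj Λ (toℕ i) (toℕ j)
  ; adj-sym = λ i j → layoutAdj-sym Λ (toℕ i) (toℕ j)
  ; irrefl  = λ i → layoutAdj-irrefl Λ (toℕ i)
  }

-- layoutPoly Λ b₀ b₁ n counts the independent sets of the layout graph on n vertices that avoid
-- vertex 0 if b₀ and vertex 1 if b₁.
layoutPoly : Layout → Bool → Bool → ℕ → Poly
layoutPoly Λ b₀    b₁ zero    = 𝟙
layoutPoly Λ true  b₁ (suc n) = layoutPoly (shift Λ) b₁ false n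
layoutPoly Λ false b₁ (suc n) =
  layoutPoly (shift Λ) b₁ false n ⊕ x· layoutPoly (shift Λ) (b₁ ∨ short Λ 0) (long Λ 0) n

layoutPoly-local : ∀ n {Λ Λ′ b₀ b₀′ b₁ b₁′} →
  (∀ w → suc w < n → short Λ w ≡ short Λ′ w) → (∀ w → 2 + w < n → long Λ w ≡ long Λ′ w) →
  (0 < n → b₀ ≡ b₀′) → (1 < n → b₁ ≡ b₁′) →
  layoutPoly Λ b₀ b₁ n ≗ layoutPoly Λ′ b₀′ b₁′ n
layoutPoly-local zero _ _ _ _ = λ _ → refl
layoutPoly-local (suc n) {b₀ = true} {b₀′ = true} s l _ e₁ =
  layoutPoly-local n (λ w → s (suc w) ∘ s≤s) (λ w → l (suc w) ∘ s≤s) (e₁ ∘ s≤s) (λ _ → refl)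
layoutPoly-local (suc n) {b₀ = false} {b₀′ = false} s l _ e₁ = ⊕-cong
  (layoutPoly-local n (λ w → s (suc w) ∘ s≤s) (λ w → l (suc w) ∘ s≤s) (e₁ ∘ s≤s) (λ _ → refl))
  (x·-cong (layoutPoly-local n (λ w → s (suc w) ∘ s≤s) (λ w → l (suc w) ∘ s≤s)
    (λ p → cong₂ _∨_ (e₁ (s≤s p)) (s 0 (s≤s p))) (l 0 ∘ s≤s)))
layoutPoly-local (suc n) {b₀ = true} {b₀′ = false} _ _ e₀ _ with () ← e₀ (s≤s z≤n)
layoutPoly-local (suc n) {b₀ = false} {b₀′ = true} _ _ e₀ _ with () ← e₀ (s≤s z≤n)

IsPath : Layout → Set
IsPath Λ = (∀ w → short Λ w ≡ true) × (∀ w → long Λ w ≡ false)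

IsPath-shift : ∀ {Λ} → IsPath Λ → IsPath (shift Λ)
IsPath-shift (s , l) = s ∘ suc , l ∘ suc

mutual
  layoutPoly-path : ∀ {Λ} → IsPath Λ → ∀ n → layoutPoly Λ false false n ≗ fib (2 + n)
  layoutPoly-path _ zero zero    = refl
  layoutPoly-path _ zero (suc k) = refl
  layoutPoly-path path@(s , l) (suc n) rewrite s 0 | l 0 =
    ⊕-cong (layoutPoly-path (IsPath-shift path) n) (x·-cong (layoutPoly-path-blocked (IsPath-shift path) n))

  layoutPoly-path-blocked : ∀ {Λ} → IsPath Λ → ∀ n → layoutPoly Λ true false n ≗ fib (1 + n)
  layoutPoly-path-blocked _ zero = λ _ → refl
  layoutPoly-path-blocked path (suc n) = layoutPoly-path (IsPath-shift path) n

IsTriangleTail : Layout → Set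
IsTriangleTail Λ = short Λ 0 ≡ true × long Λ 0 ≡ true × IsPath (shift Λ)

layoutPoly-triangleTail : ∀ {Λ} → IsTriangleTail Λ → ∀ n →
  layoutPoly Λ false false (2 + n) ≗ fib (3 + n) ⊕ x· fib (1 + n)
layoutPoly-triangleTail (s₀ , l₀ , path) n rewrite s₀ | l₀ =
  ⊕-cong (layoutPoly-path path (suc n)) (x·-cong (layoutPoly-path-blocked (IsPath-shift path) n))

record CutAt (m : ℕ) (Λ : Layout) (b₀ b₁ : Bool) : Set where
  field
    free₀     : m ≡ 0 → b₀ ≡ false
    free₁     : m ≤ 1 → b₁ ≡ false
    short-cut : ∀ w → suc w ≡ m → short Λ w ≡ false
    long-cut₁ : ∀ w → suc w ≡ m → long Λ w ≡ false
    long-cut₂ : ∀ w → 2 + w ≡ m → long Λ w ≡ false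

CutAt-skip : ∀ {m Λ b₀ b₁} → CutAt (suc m) Λ b₀ b₁ → CutAt m (shift Λ) b₁ false
CutAt-skip c = record
  { free₀     = λ { refl → free₁ (s≤s z≤n) }
  ; free₁     = λ _ → refl
  ; short-cut = λ w → short-cut (suc w) ∘ cong suc
  ; long-cut₁ = λ w → long-cut₁ (suc w) ∘ cong suc
  ; long-cut₂ = λ w → long-cut₂ (suc w) ∘ cong suc
  }
  where open CutAt c

CutAt-take : ∀ {m Λ b₀ b₁} → CutAt (suc m) Λ b₀ b₁ → CutAt m (shift Λ) (b₁ ∨ short Λ 0) (long Λ 0)
CutAt-take c = record
  { free₀     = λ { refl → cong₂ _∨_ (free₁ (s≤s z≤n)) (short-cut 0 refl) }
  ; free₁     = λ { z≤n → long-cut₁ 0 refl ; (s≤s z≤n) → long-cut₂ 0 refl }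
  ; short-cut = λ w → short-cut (suc w) ∘ cong suc
  ; long-cut₁ = λ w → long-cut₁ (suc w) ∘ cong suc
  ; long-cut₂ = λ w → long-cut₂ (suc w) ∘ cong suc
  }
  where open CutAt c

layoutPoly-split : ∀ m n {Λ b₀ b₁} → CutAt m Λ b₀ b₁ →
  layoutPoly Λ b₀ b₁ (m + n) ≗ layoutPoly Λ b₀ b₁ m ⊛ layoutPoly (shiftBy m Λ) false false n
layoutPoly-split zero n c k with CutAt.free₀ c refl | CutAt.free₁ c z≤n
... | refl | refl = sym (⊛-identityˡ _ k)
layoutPoly-split (suc m) n {b₀ = true} c = layoutPoly-split m n (CutAt-skip c)
layoutPoly-split (suc m) n {Λ} {b₀ = false} {b₁} c = begin
  layoutPoly Λ′ b₁ false (m + n) ⊕ x· layoutPoly Λ′ b₁′ b₂′ (m + n)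
    ≈⟨ ⊕-cong (layoutPoly-split m n (CutAt-skip c)) (x·-cong (layoutPoly-split m n (CutAt-take c))) ⟩
  layoutPoly Λ′ b₁ false m ⊛ R ⊕ x· (layoutPoly Λ′ b₁′ b₂′ m ⊛ R)
    ≈⟨ ⊛-step (layoutPoly Λ′ b₁ false m) (layoutPoly Λ′ b₁′ b₂′ m) R ⟨
  (layoutPoly Λ′ b₁ false m ⊕ x· layoutPoly Λ′ b₁′ b₂′ m) ⊛ R
    ∎
  where
  open ≗-Reasoning
  Λ′ = shift Λ
  b₁′ = b₁ ∨ short Λ 0
  b₂′ = long Λ 0
  R = layoutPoly (shiftBy (suc m) Λ) false false n

layoutAdj-from-zero : ∀ Λ j → layoutAdj Λ 0 (suc j) ≡ blocked (short Λ 0) (long Λ 0) j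
layoutAdj-from-zero Λ zero          = trans (∨-identityʳ _) (∨-identityʳ _)
layoutAdj-from-zero Λ (suc zero)    = ∨-identityʳ _
layoutAdj-from-zero Λ (suc (suc j)) = sym (blocked-none j)

avoids-blocked-take : ∀ {n} Λ b₁ (s : Vec Bool n) →
  avoids (blocked (b₁ ∨ short Λ 0) (long Λ 0)) s ≡ avoids (blocked b₁ false) s ∧ avoids (layoutAdj Λ 0 ∘ suc) s
avoids-blocked-take Λ b₁ s = begin
  avoids (blocked (b₁ ∨ short Λ 0) (long Λ 0)) s
    ≡⟨ avoids-cong (λ j → sym (blocked-∨ b₁ false (short Λ 0) (long Λ 0) j)) s ⟩
  avoids (λ j → blocked b₁ false j ∨ blocked (short Λ 0) (long Λ 0) j) s
    ≡⟨ avoids-∨ (blocked b₁ false) (blocked (short Λ 0) (long Λ 0)) s ⟩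
  avoids (blocked b₁ false) s ∧ avoids (blocked (short Λ 0) (long Λ 0)) s
    ≡⟨ cong (avoids (blocked b₁ false) s ∧_) (avoids-cong (sym ∘ layoutAdj-from-zero Λ) s) ⟩
  avoids (blocked b₁ false) s ∧ avoids (layoutAdj Λ 0 ∘ suc) s
    ∎
  where open ≡-Reasoning

layoutPoly-counts : ∀ n Λ b₀ b₁ →
  subsetPoly n (λ s → independent (layoutAdj Λ) s ∧ avoids (blocked b₀ b₁) s) ≗ layoutPoly Λ b₀ b₁ n
layoutPoly-counts zero Λ b₀ b₁ zero    = refl
layoutPoly-counts zero Λ b₀ b₁ (suc k) = refl
layoutPoly-counts (suc n) Λ true b₁ = begin
  subsetPoly (suc n) p
    ≈⟨ subsetPoly-suc n p ⟩
  subsetPoly n (p ∘ (false ∷_)) ⊕ x· subsetPoly n (p ∘ (true ∷_))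
    ≈⟨ ⊕-cong (layoutPoly-counts n (shift Λ) b₁ false)
              (x·-cong (subsetPoly-none n (λ s → ∧-zeroʳ (avoids _ s ∧ independent _ s)))) ⟩
  layoutPoly (shift Λ) b₁ false n ⊕ x· 𝟘
    ≈⟨ ⊕-cong (λ _ → refl) x·-zero ⟩
  layoutPoly (shift Λ) b₁ false n ⊕ 𝟘
    ≈⟨ ⊕-identityʳ _ ⟩
  layoutPoly (shift Λ) b₁ false n
    ∎
  where
  open ≗-Reasoning
  p = λ s → independent (layoutAdj Λ) s ∧ avoids (blocked true b₁) s
layoutPoly-counts (suc n) Λ false b₁ = begin
  subsetPoly (suc n) p
    ≈⟨ subsetPoly-suc n p ⟩
  subsetPoly n (p ∘ (false ∷_)) ⊕ x· subsetPoly n (p ∘ (true ∷_))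
    ≈⟨ ⊕-cong (layoutPoly-counts n (shift Λ) b₁ false) (x·-cong (subsetPoly-cong n taken)) ⟩
  layoutPoly (shift Λ) b₁ false n ⊕ x· subsetPoly n (λ s → I s ∧ avoids (blocked (b₁ ∨ short Λ 0) (long Λ 0)) s)
    ≈⟨ ⊕-cong (λ _ → refl) (x·-cong (layoutPoly-counts n (shift Λ) (b₁ ∨ short Λ 0) (long Λ 0))) ⟩
  layoutPoly (shift Λ) b₁ false n ⊕ x· layoutPoly (shift Λ) (b₁ ∨ short Λ 0) (long Λ 0) n
    ∎
  where
  open ≗-Reasoning
  p = λ s → independent (layoutAdj Λ) s ∧ avoids (blocked false b₁) s
  I = independent (layoutAdj (shift Λ))
  rearrange : ∀ a i b → (a ∧ i) ∧ b ≡ i ∧ (b ∧ a)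
  rearrange false i b = sym (trans (cong (i ∧_) (∧-zeroʳ b)) (∧-zeroʳ i))
  rearrange true  i b = cong (i ∧_) (sym (∧-identityʳ b))
  taken : ∀ s → p (true ∷ s) ≡ I s ∧ avoids (blocked (b₁ ∨ short Λ 0) (long Λ 0)) s
  taken s = trans (rearrange (avoids (layoutAdj Λ 0 ∘ suc) s) (I s) (avoids (blocked b₁ false) s))
                  (cong (I s ∧_) (sym (avoids-blocked-take Λ b₁ s)))

indepCoeff-layoutGraph : ∀ Λ n → indepCoeff (n , layoutGraph Λ n) ≗ layoutPoly Λ false false n
indepCoeff-layoutGraph Λ n = begin
  subsetPoly n (noEdgeWithin (layoutAdj Λ))
    ≈⟨ subsetPoly-cong n (λ s → trans (noEdgeWithin≡independent A (layoutAdj-sym Λ) (layoutAdj-irrefl Λ) s)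
                                      (sym (trans (cong (independent A s ∧_) (avoids-none s)) (∧-identityʳ _)))) ⟩
  subsetPoly n (λ s → independent A s ∧ avoids (blocked false false) s)
    ≈⟨ layoutPoly-counts n Λ false false ⟩
  layoutPoly Λ false false n
    ∎
  where
  open ≗-Reasoning
  A = layoutAdj Λ

pathLayout : Layout
pathLayout = record { short = λ _ → true ; long = λ _ → false }

forwardEdge-pathLayout : ∀ i j → forwardEdge pathLayout i j ≡ (suc i ≡ᵇ j)
forwardEdge-pathLayout i j rewrite ∧-identityʳ (suc i ≡ᵇ j) | ∧-zeroʳ (2 + i ≡ᵇ j) = ∨-identityʳ _

indepCoeff-P : ∀ n → indepCoeff (P n) ≗ fib (2 + n)
indepCoeff-P n = begin
  indepCoeff (P n)
    ≈⟨ indepCoeff-cong {G = proj₂ (P n)} {H = layoutGraph pathLayout n} (λ i j → sym (cong₂ _∨_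
         (forwardEdge-pathLayout (toℕ i) (toℕ j)) (forwardEdge-pathLayout (toℕ j) (toℕ i)))) ⟩
  indepCoeff (n , layoutGraph pathLayout n)
    ≈⟨ indepCoeff-layoutGraph pathLayout n ⟩
  layoutPoly pathLayout false false n
    ≈⟨ layoutPoly-path ((λ _ → refl) , (λ _ → refl)) n ⟩
  fib (2 + n)
    ∎
  where open ≗-Reasoning

forwardEdge⇒ : ∀ Λ i j → T (forwardEdge Λ i j) → (j ≡ suc i × T (short Λ i)) ⊎ (j ≡ 2 + i × T (long Λ i))
forwardEdge⇒ Λ i j t with Equivalence.to (T-∨ {(suc i ≡ᵇ j) ∧ short Λ i}) t
... | inj₁ t₁ = let (e , s) = Equivalence.to (T-∧ {suc i ≡ᵇ j}) t₁ in inj₁ (sym (≡ᵇ⇒≡ _ _ e) , s)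
... | inj₂ t₂ = let (e , l) = Equivalence.to (T-∧ {2 + i ≡ᵇ j}) t₂ in inj₂ (sym (≡ᵇ⇒≡ _ _ e) , l)

forwardEdge⇐ : ∀ Λ i j → (j ≡ suc i × T (short Λ i)) ⊎ (j ≡ 2 + i × T (long Λ i)) → T (forwardEdge Λ i j)
forwardEdge⇐ Λ i j (inj₁ (refl , s)) =
  Equivalence.from (T-∨ {(suc i ≡ᵇ j) ∧ short Λ i})
    (inj₁ (Equivalence.from (T-∧ {suc i ≡ᵇ j}) (≡⇒≡ᵇ j j refl , s)))
forwardEdge⇐ Λ i j (inj₂ (refl , l)) =
  Equivalence.from (T-∨ {(suc i ≡ᵇ j) ∧ short Λ i})
    (inj₂ (Equivalence.from (T-∧ {2 + i ≡ᵇ j}) (≡⇒≡ᵇ j j refl , l)))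

layoutAdj-forward : ∀ Λ x y → T (forwardEdge Λ x y) → T (layoutAdj Λ x y)
layoutAdj-forward Λ x y t = Equivalence.from (T-∨ {forwardEdge Λ x y}) (inj₁ t)

layoutAdj-backward : ∀ Λ x y → T (forwardEdge Λ y x) → T (layoutAdj Λ x y)
layoutAdj-backward Λ x y t = Equivalence.from (T-∨ {forwardEdge Λ x y}) (inj₂ t)

Adjacency : Layout → ℕ → ℕ → Set
Adjacency Λ x y = (y ≡ suc x × T (short Λ x)) ⊎ (y ≡ 2 + x × T (long Λ x))
                ⊎ (x ≡ suc y × T (short Λ y)) ⊎ (x ≡ 2 + y × T (long Λ y))

layoutAdj⇒ : ∀ Λ x y → T (layoutAdj Λ x y) → Adjacency Λ x y
layoutAdj⇒ Λ x y t with Equivalence.to (T-∨ {forwardEdge Λ x y}) t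
... | inj₁ t₁ with forwardEdge⇒ Λ x y t₁
...   | inj₁ p = inj₁ p
...   | inj₂ p = inj₂ (inj₁ p)
layoutAdj⇒ Λ x y t | inj₂ t₂ with forwardEdge⇒ Λ y x t₂
...   | inj₁ p = inj₂ (inj₂ (inj₁ p))
...   | inj₂ p = inj₂ (inj₂ (inj₂ p))

Guarded : Layout → Set
Guarded Λ = ∀ w → T (long Λ (suc w)) → ¬ T (short Λ w)

LongEdgeInto : Layout → ℕ → Set
LongEdgeInto Λ x = Σ ℕ λ w → x ≡ 2 + w × T (long Λ w)

longEdgeInto? : ∀ Λ x → LongEdgeInto Λ x ⊎ (∀ w → x ≡ 2 + w → ¬ T (long Λ w))
longEdgeInto? Λ zero          = inj₂ λ _ ()
longEdgeInto? Λ (suc zero)    = inj₂ λ _ ()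
longEdgeInto? Λ (suc (suc w)) with long Λ w in e
... | true  = inj₁ (w , refl , Equivalence.from T-≡ e)
... | false = inj₂ λ { _ refl t → subst T e t }

AmongTwo : ℕ → ℕ → ℕ → Set
AmongTwo a b y = Σ (Fin 2) λ c → y ≡ lookup (a ∷ b ∷ []) c

-- By the guard, a long edge out of x excludes a short edge into x.
neighbours-two : ∀ Λ x → Guarded Λ → (∀ w → x ≡ 2 + w → ¬ T (long Λ w)) →
  Σ ℕ λ t → ∀ y → T (layoutAdj Λ x y) → AmongTwo (suc x) t y
neighbours-two Λ x guarded noInto = by-long (long Λ x) refl
  where
  by-long : ∀ b → long Λ x ≡ b → Σ ℕ λ t → ∀ y → T (layoutAdj Λ x y) → AmongTwo (suc x) t y
  by-long true e = 2 + x , λ y t → classify y (layoutAdj⇒ Λ x y t)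
    where
    classify : ∀ y → Adjacency Λ x y → AmongTwo (suc x) (2 + x) y
    classify y (inj₁ (p , _))               = Fin.zero , p
    classify y (inj₂ (inj₁ (p , _)))        = Fin.suc Fin.zero , p
    classify y (inj₂ (inj₂ (inj₁ (p , s)))) = ⊥-elim (guarded y (subst (T ∘ long Λ) p (Equivalence.from T-≡ e)) s)
    classify y (inj₂ (inj₂ (inj₂ (p , l)))) = ⊥-elim (noInto y p l)
  by-long false e = pred x , λ y t → classify y (layoutAdj⇒ Λ x y t)
    where
    classify : ∀ y → Adjacency Λ x y → AmongTwo (suc x) (pred x) y
    classify y (inj₁ (p , _))               = Fin.zero , p
    classify y (inj₂ (inj₁ (_ , l)))        = ⊥-elim (subst T e l)
    classify y (inj₂ (inj₂ (inj₁ (p , _)))) = Fin.suc Fin.zero , cong pred (sym p)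
    classify y (inj₂ (inj₂ (inj₂ (p , l)))) = ⊥-elim (noInto y p l)

threeNeighbours⇒longEdgeInto : ∀ {Λ n} → Guarded Λ → (v : Fin n) →
  HasThreeNeighbours (layoutGraph Λ n) v → LongEdgeInto Λ (toℕ v)
threeNeighbours⇒longEdgeInto {Λ} guarded v (u , u-inj , u-adj) with longEdgeInto? Λ (toℕ v)
... | inj₁ into   = into
... | inj₂ noInto = ⊥-elim (3≰2 (injective⇒≤ side-injective))
  where
  3≰2 : ¬ 3 ≤ 2
  3≰2 (s≤s (s≤s ()))
  two = neighbours-two Λ (toℕ v) guarded noInto
  targets = suc (toℕ v) ∷ proj₁ two ∷ []
  side : Fin 3 → Fin 2
  side c = proj₁ (proj₂ two (toℕ (u c)) (u-adj c))
  located : ∀ c → toℕ (u c) ≡ lookup targets (side c)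
  located c = proj₂ (proj₂ two (toℕ (u c)) (u-adj c))
  side-injective : Injective _≡_ _≡_ side
  side-injective {c} {d} e =
    u-inj (toℕ-injective (trans (located c) (trans (cong (lookup targets) e) (sym (located d)))))

order : ℕ → ℕ
order zero    = 1
order (suc i) = 2 + (order i + order i)

order-≥1 : ∀ i → 1 ≤ order i
order-≥1 zero    = s≤s z≤n
order-≥1 (suc i) = s≤s z≤n

order-growth : ∀ i → 3 + order i ≤ order (suc i)
order-growth i = s≤s (s≤s (+-monoˡ-≤ (order i) (order-≥1 i)))

order-mono-≤ : ∀ {i j} → i ≤ j → order i ≤ order j
order-mono-≤ = go ∘ ≤⇒≤′
  where
  go : ∀ {i j} → i ≤′ j → order i ≤ order j
  go ≤′-refl           = ≤-refl
  go (≤′-step {n} i≤j) = ≤-trans (go i≤j) (≤-trans (m≤n+m (order n) 3) (order-growth n))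

order-<-suc : ∀ i → order i < order (suc i)
order-<-suc i = ≤-trans (m≤n+m (suc (order i)) 2) (order-growth i)

order-mono-< : ∀ {i j} → i < j → order i < order j
order-mono-< {i} i<j = <-≤-trans (order-<-suc i) (order-mono-≤ i<j)

order-cancel-< : ∀ {i j} → order i < order j → i < j
order-cancel-< lt = ≰⇒> λ j≤i → <⇒≱ lt (order-mono-≤ j≤i)

order-injective : Injective _≡_ _≡_ order
order-injective {i} {j} e with <-cmp i j
... | tri< i<j _ _ = ⊥-elim (<⇒≢ (order-mono-< i<j) e)
... | tri≈ _ i≡j _ = i≡j
... | tri> _ _ j<i = ⊥-elim (>⇒≢ (order-mono-< j<i) e)

order-gap : ∀ {i} → 1 ≤ i → 4 + order i ≤ order (suc i)
order-gap {suc i} _ = s≤s (s≤s (+-monoˡ-≤ (order (suc i)) (s≤s (s≤s z≤n))))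

order-suc-even : ∀ i → order (suc i) ≡ 2 * suc (order i)
order-suc-even i = cong suc (sym (trans
  (+-suc (order i) (order i + 0)) (cong (suc ∘ (order i +_)) (+-identityʳ (order i)))))

≡ᵇ-refl : ∀ m → (m ≡ᵇ m) ≡ true
≡ᵇ-refl m = Equivalence.to T-≡ (≡⇒≡ᵇ m m refl)

≢⇒≡ᵇ-false : ∀ {m n} → m ≢ n → (m ≡ᵇ n) ≡ false
≢⇒≡ᵇ-false {m} {n} m≢n = ¬-not (m≢n ∘ ≡ᵇ⇒≡ m n ∘ Equivalence.from T-≡)

isMarker : ℕ → ℕ → ℕ → Bool
isMarker s zero    w = false
isMarker s (suc r) w = isMarker s r w ∨ (order (r + s) ≡ᵇ w)

-- The path on order (r + s) vertices in which, at every marker m = order (j + s) with j < r,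
-- the edge m − 1 — m is replaced by the edge m — m + 2.
marked : ℕ → ℕ → Layout
marked s r = record { short = not ∘ isMarker s r ∘ suc ; long = isMarker s r }

isMarker-index : ∀ s r {w} → isMarker s r w ≡ true → Σ (Fin r) λ j → order (toℕ j + s) ≡ w
isMarker-index s (suc r) {w} e with isMarker s r w in e′
... | true  = let (j , p) = isMarker-index s r e′ in inject₁ j , trans (cong (order ∘ (_+ s)) (toℕ-inject₁ j)) p
... | false = fromℕ r , trans (cong (order ∘ (_+ s)) (toℕ-fromℕ r)) (≡ᵇ⇒≡ _ _ (Equivalence.from T-≡ e))

isMarker-suc-top : ∀ s r → isMarker s (suc r) (order (r + s)) ≡ true
isMarker-suc-top s r = trans (cong (isMarker s r (order (r + s)) ∨_) (≡ᵇ-refl (order (r + s)))) (∨-zeroʳ _)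

isMarker-at : ∀ s r {j} → j < r → isMarker s r (order (j + s)) ≡ true
isMarker-at s (suc r) {j} (s≤s j≤r) with m≤n⇒m<n∨m≡n j≤r
... | inj₁ j<r  = cong (_∨ (order (r + s) ≡ᵇ order (j + s))) (isMarker-at s r j<r)
... | inj₂ refl = isMarker-suc-top s r

isMarker-between : ∀ s r {i w} → order i < w → w < order (suc i) → isMarker s r w ≡ false
isMarker-between s r {i} lo hi = ¬-not λ e → let (j , p) = isMarker-index s r e in
  <⇒≱ (subst (_< order (suc i)) (sym p) hi)
      (order-mono-≤ {suc i} {toℕ j + s} (order-cancel-< (subst (order i <_) (sym p) lo)))

isMarker-close-to-top : ∀ s r {w} → order (r + s) < 3 + w → isMarker s r w ≡ false
isMarker-close-to-top s r {w} lt = ¬-not λ e → let (j , p) = isMarker-index s r e in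
  <⇒≱ lt (subst (λ v → 3 + v ≤ order (r + s)) p
    (≤-trans (order-growth (toℕ j + s)) (order-mono-≤ (+-monoˡ-≤ s (toℕ<n j)))))

isMarker-suc-other : ∀ s r {w} → order (r + s) ≢ w → isMarker s (suc r) w ≡ isMarker s r w
isMarker-suc-other s r {w} ne = trans (cong (isMarker s r w ∨_) (≢⇒≡ᵇ-false ne)) (∨-identityʳ _)

isMarker-suc-close-to-top : ∀ s r {w} → order (r + s) ≢ w → order (r + s) < 3 + w → isMarker s (suc r) w ≡ false
isMarker-suc-close-to-top s r ne lt = trans (isMarker-suc-other s r ne) (isMarker-close-to-top s r lt)

isMarker-suc-beyond : ∀ s r {w} → order (r + s) < w → isMarker s (suc r) w ≡ false
isMarker-suc-beyond s r {w} lt = isMarker-suc-close-to-top s r (<⇒≢ lt) (≤-trans lt (m≤n+m w 3))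

isMarker-suc-window : ∀ s r {w} → w < order (r + s) → order (r + s) ≤ 2 + w → isMarker s (suc r) w ≡ false
isMarker-suc-window s r lt ge = isMarker-suc-close-to-top s r (>⇒≢ lt) (s≤s ge)

layoutPoly-marked : ∀ s r → layoutPoly (marked s r) false false (order (r + s)) ≗ fib (2 + order (r + s))
layoutPoly-marked s zero    = layoutPoly-path ((λ _ → refl) , (λ _ → refl)) (order s)
layoutPoly-marked s (suc r) = begin
  layoutPoly Λ false false (2 + (A + A))
    ≡⟨ cong (λ n → layoutPoly Λ false false n) (trans (+-suc A (suc A)) (cong suc (+-suc A A))) ⟨
  layoutPoly Λ false false (A + (2 + A))
    ≈⟨ layoutPoly-split A (2 + A) cut ⟩
  layoutPoly Λ false false A ⊛ layoutPoly (shiftBy A Λ) false false (2 + A)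
    ≈⟨ ⊛-cong (layoutPoly-local A below-short below-long (λ _ → refl) (λ _ → refl))
              (layoutPoly-triangleTail {shiftBy A Λ} triangleTail A) ⟩
  layoutPoly (marked s r) false false A ⊛ (fib (3 + A) ⊕ x· fib (1 + A))
    ≈⟨ ⊛-cong (layoutPoly-marked s r) (λ _ → refl) ⟩
  fib (2 + A) ⊛ (fib (3 + A) ⊕ x· fib (1 + A))
    ≈⟨ fib-double A ⟩
  fib (4 + (A + A))
    ∎
  where
  open ≗-Reasoning
  A = order (r + s)
  Λ = marked s (suc r)
  cut : CutAt A Λ false false
  cut = record
    { free₀     = λ _ → refl
    ; free₁     = λ _ → refl
    ; short-cut = λ w e → cong not (trans (cong (isMarker s (suc r)) e) (isMarker-suc-top s r))
    ; long-cut₁ = λ w e → isMarker-suc-window s r (subst (w <_) e ≤-refl) (subst (_≤ 2 + w) e (n≤1+n _))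
    ; long-cut₂ = λ w e → isMarker-suc-window s r (subst (w <_) e (n≤1+n _)) (≤-reflexive (sym e))
    }
  below-short : ∀ w → suc w < A → short Λ w ≡ short (marked s r) w
  below-short w lt = cong not (isMarker-suc-other s r (>⇒≢ lt))
  below-long : ∀ w → 2 + w < A → long Λ w ≡ long (marked s r) w
  below-long w lt = isMarker-suc-other s r (>⇒≢ (≤-trans (m≤n+m (suc w) 2) lt))
  triangleTail : IsTriangleTail (shiftBy A Λ)
  triangleTail =
      cong not (isMarker-suc-beyond s r (s≤s (m≤m+n A 0)))
    , trans (cong (isMarker s (suc r)) (+-identityʳ A)) (isMarker-suc-top s r)
    , (λ w → cong not (isMarker-suc-beyond s r (s≤s (m≤m+n A (suc w)))))
    , (λ w → isMarker-suc-beyond s r (m<m+n A (s≤s z≤n)))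

marked-guarded : ∀ s r → Guarded (marked s r)
marked-guarded s r w marker unmarked = subst T (Equivalence.to T-not-≡ unmarked) marker

branchVertices-marked-≤ : ∀ s r {n r′} → HasBranchVertices (layoutGraph (marked s r) n) r′ → r′ ≤ r
branchVertices-marked-≤ s r (g , g-inj , three) = injective⇒≤ index-injective
  where
  into = λ i → threeNeighbours⇒longEdgeInto {marked s r} (marked-guarded s r) (g i) (three i)
  marker = λ i → isMarker-index s r (Equivalence.to T-≡ (proj₂ (proj₂ (into i))))
  index = λ i → proj₁ (marker i)
  position : ∀ i → toℕ (g i) ≡ 2 + order (toℕ (index i) + s)
  position i = trans (proj₁ (proj₂ (into i))) (cong (2 +_) (sym (proj₂ (marker i))))
  index-injective : Injective _≡_ _≡_ index
  index-injective {i} {j} e =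
    g-inj (toℕ-injective (trans (position i) (trans (cong (λ c → 2 + order (toℕ c + s)) e) (sym (position j)))))

-- The neighbours m, m + 1, m + 3 of the branch vertex m + 2 at a marker m.
offset : Fin 3 → ℕ
offset Fin.zero                     = 0
offset (Fin.suc Fin.zero)           = 1
offset (Fin.suc (Fin.suc Fin.zero)) = 3

offset-≤ : ∀ k → offset k ≤ 3
offset-≤ Fin.zero                     = z≤n
offset-≤ (Fin.suc Fin.zero)           = s≤s z≤n
offset-≤ (Fin.suc (Fin.suc Fin.zero)) = ≤-refl

offset-injective : Injective _≡_ _≡_ offset
offset-injective {Fin.zero} {Fin.zero}                                     _ = refl
offset-injective {Fin.suc Fin.zero} {Fin.suc Fin.zero}                     _ = refl
offset-injective {Fin.suc (Fin.suc Fin.zero)} {Fin.suc (Fin.suc Fin.zero)} _ = refl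
offset-injective {Fin.zero} {Fin.suc Fin.zero}                             ()
offset-injective {Fin.zero} {Fin.suc (Fin.suc Fin.zero)}                   ()
offset-injective {Fin.suc Fin.zero} {Fin.zero}                             ()
offset-injective {Fin.suc Fin.zero} {Fin.suc (Fin.suc Fin.zero)}           ()
offset-injective {Fin.suc (Fin.suc Fin.zero)} {Fin.zero}                   ()
offset-injective {Fin.suc (Fin.suc Fin.zero)} {Fin.suc Fin.zero}           ()

marker-neighbours : ∀ s r {j} → 1 ≤ s → j < r → ∀ k →
  T (layoutAdj (marked s r) (2 + order (j + s)) (offset k + order (j + s)))
marker-neighbours s r {j} 1≤s j<r = adjacent
  where
  Λ = marked s r
  o = order (j + s)
  unmarked : ∀ {w} → o < w → w < 4 + o → T (not (isMarker s r w))
  unmarked lo hi =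
    Equivalence.from T-not-≡ (isMarker-between s r {j + s} lo (<-≤-trans hi (order-gap (≤-trans 1≤s (m≤n+m s j)))))
  adjacent : ∀ k → T (layoutAdj Λ (2 + o) (offset k + o))
  adjacent Fin.zero = layoutAdj-backward Λ (2 + o) o
    (forwardEdge⇐ Λ o (2 + o) (inj₂ (refl , Equivalence.from T-≡ (isMarker-at s r j<r))))
  adjacent (Fin.suc Fin.zero) = layoutAdj-backward Λ (2 + o) (1 + o)
    (forwardEdge⇐ Λ (1 + o) (2 + o)
      (inj₁ (refl , unmarked (m<n+m o {2} (s≤s z≤n)) (m<n+m (2 + o) {2} (s≤s z≤n)))))
  adjacent (Fin.suc (Fin.suc Fin.zero)) = layoutAdj-forward Λ (2 + o) (3 + o)
    (forwardEdge⇐ Λ (2 + o) (3 + o) (inj₁ (refl , unmarked (m<n+m o {3} (s≤s z≤n)) ≤-refl)))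

branchVertices-marked : ∀ s r → 1 ≤ s → HasBranchVertices (layoutGraph (marked s r) (order (r + s))) r
branchVertices-marked s r 1≤s = vertex , vertex-injective , three
  where
  n = order (r + s)
  o : Fin r → ℕ
  o c = order (toℕ c + s)
  fits : ∀ c → 4 + o c ≤ n
  fits c = ≤-trans (order-gap (≤-trans 1≤s (m≤n+m s (toℕ c)))) (order-mono-≤ (+-monoˡ-≤ s (toℕ<n c)))
  vertex-bound : ∀ c → 2 + o c < n
  vertex-bound c = ≤-trans (n≤1+n _) (fits c)
  vertex : Fin r → Fin n
  vertex c = fromℕ< (vertex-bound c)
  vertex-injective : Injective _≡_ _≡_ vertex
  vertex-injective {c} {d} e = toℕ-injective (+-cancelʳ-≡ s _ _ (order-injective (suc-injective (suc-injective
    (trans (sym (toℕ-fromℕ< (vertex-bound c))) (trans (cong toℕ e) (toℕ-fromℕ< (vertex-bound d))))))))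
  three : ∀ c → HasThreeNeighbours (layoutGraph (marked s r) n) (vertex c)
  three c = neighbour , neighbour-injective , λ k → subst₂ (λ x y → T (layoutAdj (marked s r) x y))
      (sym (toℕ-fromℕ< (vertex-bound c))) (sym (toℕ-fromℕ< (neighbour-bound k)))
      (marker-neighbours s r 1≤s (toℕ<n c) k)
    where
    neighbour-bound : ∀ k → offset k + o c < n
    neighbour-bound k = <-≤-trans (s≤s (+-monoˡ-≤ (o c) (offset-≤ k))) (fits c)
    neighbour : Fin 3 → Fin n
    neighbour k = fromℕ< (neighbour-bound k)
    neighbour-injective : Injective _≡_ _≡_ neighbour
    neighbour-injective {k} {l} e = offset-injective (+-cancelʳ-≡ (o c) _ _
      (trans (sym (toℕ-fromℕ< (neighbour-bound k))) (trans (cong toℕ e) (toℕ-fromℕ< (neighbour-bound l)))))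

markedGraph : ℕ → ℕ → AnyGraph
markedGraph s r = order (r + s) , layoutGraph (marked s r) (order (r + s))

indepCoeff-markedGraph : ∀ s r → indepCoeff (markedGraph s r) ≗ fib (2 + order (r + s))
indepCoeff-markedGraph s r k =
  trans (indepCoeff-layoutGraph (marked s r) (order (r + s)) k) (layoutPoly-marked s r k)

markedGraph-Iso-≤ : ∀ {s s′ r r′} → 1 ≤ s → Iso (markedGraph s r) (markedGraph s′ r′) → r ≤ r′
markedGraph-Iso-≤ {s} {s′} {r} {r′} 1≤s iso = branchVertices-marked-≤ s′ r′
  (HasBranchVertices-Iso {G = proj₂ (markedGraph s r)} {H = proj₂ (markedGraph s′ r′)} iso
    (branchVertices-marked s r 1≤s))

proposition5 : (K : ℕ) → ∃[ n ] ∃[ m ] (n ≡ 2 * m) ×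
    Σ (Fin K → AnyGraph) (λ Gs →
    (∀ a → IndepEquiv (Gs a) (P n)) ×
    (∀ a b → Iso (Gs a) (Gs b) → a ≡ b))
proposition5 K = order (suc K) , suc (order K) , order-suc-even K , graph , equivalent , distinct
  where
  start : Fin K → ℕ
  start c = suc (K ∸ toℕ c)
  graph : Fin K → AnyGraph
  graph c = markedGraph (start c) (toℕ c)
  total : ∀ c → toℕ c + start c ≡ suc K
  total c = trans (+-suc (toℕ c) _) (cong suc (m+[n∸m]≡n (<⇒≤ (toℕ<n c))))
  equivalent : ∀ c → IndepEquiv (graph c) (P (order (suc K)))
  equivalent c k = trans (indepCoeff-markedGraph (start c) (toℕ c) k)
    (trans (cong (λ t → fib (2 + order t) k) (total c)) (sym (indepCoeff-P (order (suc K)) k)))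
  distinct : ∀ c d → Iso (graph c) (graph d) → c ≡ d
  distinct c d iso = toℕ-injective
    (≤-antisym (markedGraph-Iso-≤ (s≤s z≤n) iso)
               (markedGraph-Iso-≤ (s≤s z≤n) (Iso-sym {graph c} {graph d} iso)))
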